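{- Let $G=(V,A,s)$ be a flow graph, let $T$ be a depth-first spanning tree of $G$ with parent function $p$, and let $H$ (with parent function $h$) be the loop nesting forest of $G$ with respect to $T$. Form $G'$ from $G$ as follows: delete all back arcs of $G$ (with respect to $T$); for each vertex $u$ such that $h(u)$ is defined and $\mathit{loop}(u)$ and $\mathit{loop}(h(u))$ have a common non-head entry, add an arc $(p(h(u)),u)$; and for each arc $(v,w)$ that is a non-head entry of some loop, add an arc $(v,u)$, where $\mathit{loop}(u)$ is the largest loop having $(v,w)$ as an entry. Then $G$ and $G'$ (both with start vertex $s$) have the same dominators: for all vertices $x,y$, $x$ dominates $y$ in $G$ if and only if $x$ dominates $y$ in $G'$.
   Context: A flow graph $G=(V,A,s)$ is a finite directed graph with start vertex $s$ from which every vertex is reachable; assume $|V|>1$, no arcs enter $s$, and $G$ has no multiple arcs and no loop arcs ($G'$ may have multiple arcs). A vertex $x$ dominates $y$ if every path from $s$ to $y$ contains $x$. A depth-first spanning tree is the tree of parent pointers produced by a depth-first search of $G$ from $s$ (recursively visiting, from the current vertex, each not-yet-visited head of an outgoing arc). An arc $(x,w)$ is a back arc with respect to $T$ if $x$ is a proper descendant of $w$ in $T$. For a vertex $u$, $\mathit{loop}(u)$ is the set of descendants $x$ of $u$ in $T$ (including $u$) such that there is a path from $x$ to $u$ containing only descendants of $u$ in $T$; $u$ is its head. Any two loops are disjoint or nested. The loop nesting forest $H$ has parent function $h$, where $h(v)$ is the nearest proper ancestor $u$ of $v$ in $T$ with $v\in\mathit{loop}(u)$, if one exists (otherwise $h(v)$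 is undefined). An entry to $\mathit{loop}(u)$ is an arc $(v,w)$ with $w\in\mathit{loop}(u)$ and $v\notin\mathit{loop}(u)$; it is a head entry if $w=u$ and a non-head entry otherwise. -}

module Defs where

open import Data.Nat using (ℕ; _<_)
open import Data.Fin using (Fin; _≟_)
open import Data.List using (List; []; _∷_)
open import Data.List.Membership.Propositional using (_∈_; _∉_)
open import Data.List.Relation.Unary.Unique.Propositional using (Unique)
open import Data.List.Relation.Binary.Permutation.Propositional using (_↭_)
open import Data.Maybe using (Maybe; just; nothing)
open import Data.Bool using (Bool; true; false; if_then_else_)
open import Data.Product using (Σ; _×_; ∃; ∃-syntax; _,_)
open import Relation.Nullary using (¬_)
open import Relation.Nullary.Decidable using (⌊_⌋)
open import Relation.Binary.PropositionalEquality using (_≡_; _≢_)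

-- A binary relation on the vertex set Fin n (used as an arc relation;
-- multiplicity of arcs is irrelevant for paths/dominators).
VRel : ℕ → Set₁
VRel n = Fin n → Fin n → Set

Adj : ℕ → Set
Adj n = Fin n → List (Fin n)

Arc : ∀ {n} → Adj n → VRel n
Arc E v w = w ∈ E v

data Walk {n : ℕ} (R : VRel n) : Fin n → Fin n → Set where
  []  : ∀ {a} → Walk R a a
  _∷_ : ∀ {a b c} → R a b → Walk R b c → Walk R a c

data OnWalk {n : ℕ} {R : VRel n} (x : Fin n) : ∀ {a b} → Walk R a b → Set where
  here-[] : OnWalk x ([] {a = x})
  here-∷  : ∀ {b c} (r : R x b) (π : Walk R b c) → OnWalk x (r ∷ π)
  there   : ∀ {a b c} (r : R a b) {π : Walk R b c} → OnWalk x π → OnWalk x (r ∷ π)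

Dominates : ∀ {n} → VRel n → Fin n → Fin n → Fin n → Set
Dominates R s x y = (π : Walk R s y) → OnWalk x π

Restrict : ∀ {n} → VRel n → (Fin n → Set) → VRel n
Restrict R P a b = P a × P b × R a b

record IsFlowGraph {n : ℕ} (E : Adj n) (s : Fin n) : Set where
  field
    more-than-one : 1 < n
    no-multi      : ∀ v → Unique (E v)
    no-loop-arc   : ∀ v → v ∉ E v
    no-enter-s    : ∀ v → s ∉ E v
    reachable     : ∀ y → Walk (Arc E) s y

record State (n : ℕ) : Set where
  constructor st
  field
    visited : Fin n → Bool
    parent  : Fin n → Maybe (Fin n)
open State public

visit : ∀ {n} → Fin n → Fin n → State n → State n
visit w u (st vis par) =
  st (λ y → if ⌊ y ≟ w ⌋ then true else vis y)
     (λ y → if ⌊ y ≟ w ⌋ then just u else par y)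

-- A newly discovered vertex w is
-- visited recursively, its out-neighbours scanned in an arbitrary order
-- (any permutation of E w).
data DFSScan {n : ℕ} (E : Adj n) (u : Fin n) :
       List (Fin n) → State n → State n → Set where
  scan-[]  : ∀ {σ} → DFSScan E u [] σ σ
  scan-old : ∀ {w ws σ σ'} → visited σ w ≡ true →
             DFSScan E u ws σ σ' → DFSScan E u (w ∷ ws) σ σ'
  scan-new : ∀ {w ws ws' σ σ₁ σ₂} → visited σ w ≡ false →
             ws' ↭ E w → DFSScan E w ws' (visit w u σ) σ₁ →
             DFSScan E u ws σ₁ σ₂ → DFSScan E u (w ∷ ws) σ σ₂

initState : ∀ {n} → Fin n → State n
initState s = st (λ y → ⌊ y ≟ s ⌋) (λ _ → nothing)

IsDFSTree : ∀ {n} → Adj n → Fin n → (Fin n → Maybe (Fin n)) → Set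
IsDFSTree E s p =
  ∃[ vis ] ∃[ ws ] (ws ↭ E s × DFSScan E s ws (initState s) (st vis p))

module _ {n : ℕ} (p : Fin n → Maybe (Fin n)) where

  data Anc (x : Fin n) : Fin n → Set where
    anc-refl : Anc x x
    anc-step : ∀ {y z} → p y ≡ just z → Anc x z → Anc x y

  ProperAnc : Fin n → Fin n → Set
  ProperAnc x y = Anc x y × x ≢ y

  BackArc : Fin n → Fin n → Set
  BackArc x w = ProperAnc w x

module _ {n : ℕ} (E : Adj n) (p : Fin n → Maybe (Fin n)) where

  InLoop : Fin n → Fin n → Set
  InLoop u x = Anc p u x × Walk (Restrict (Arc E) (Anc p u)) x u

  IsH : Fin n → Fin n → Set
  IsH v u = ProperAnc p u v × InLoop u v ×
            (∀ u' → ProperAnc p u' v → InLoop u' v → Anc p u' u)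

  Entry : Fin n → Fin n → Fin n → Set
  Entry u v w = Arc E v w × InLoop u w × ¬ InLoop u v

  NonHeadEntry : Fin n → Fin n → Fin n → Set
  NonHeadEntry u v w = Entry u v w × w ≢ u

  LargestEntryLoop : Fin n → Fin n → Fin n → Set
  LargestEntryLoop u v w =
    Entry u v w × (∀ u' → Entry u' v w → ∀ x → InLoop u' x → InLoop u x)

  data Arc′ : VRel n where
    kept      : ∀ {x w} → Arc E x w → ¬ BackArc p x w → Arc′ x w
    loop-arc  : ∀ {u hu v w q} → IsH u hu → NonHeadEntry u v w →
                NonHeadEntry hu v w → p hu ≡ just q → Arc′ q u
    entry-arc : ∀ {u v w} → (∃[ u' ] NonHeadEntry u' v w) →
                LargestEntryLoop u v w → Arc′ v u

-- Both inclusions are proved by contraposition: a walk s ⇝ y avoiding x in one graph yields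
-- one in the other.  The constructions are classical (in the double-negation monad), which
-- suffices because occurrence on a walk is decidable.
--
-- From G′ to G, arc by arc: a kept arc stays; an added arc into u is replaced by the tree path
-- s ⇝ u, or by the entry (v , w) it stands for followed by a path inside loop(u), or, for the
-- arc (p(h(u)) , u) when h(u) is not above x, by the tree path p(h(u)) → h(u) ⇝ u.
--
-- From G to G′, by induction on length: if x is not a tree ancestor of y, take the tree path.
-- Otherwise let loop(u) be the outermost loop containing y whose head is strictly below x.
-- The first arc (v , w) of the walk entering loop(u) has an avoiding G′-prefix, and u is
-- reached from v by (v , u) itself if w = u; else by the arc (v , U) into the largest loop
-- entered by (v , w), if U is not above x; else by (p(h(u)) , u), where h(u) lies above x by
-- outermostness of loop(u), so that the tree path to p(h(u)) avoids x.

module Submission where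

open import Defs
open import Level using (0ℓ)
open import Data.Nat using (ℕ; suc; _≤_; _<_; _∸_; s≤s; z≤n)
open import Data.Nat.Properties using (≤-refl; ≤-reflexive; ≤-trans; <⇒≤; <-irrefl; <-≤-trans; ≤-<-trans; ≮⇒≥; ≰⇒>; ∸-cancelʳ-≤)
open import Data.Nat.Induction using (<-wellFounded)
open import Induction.WellFounded using (Acc; acc)
open import Data.Fin using (Fin; _≟_)
open import Data.Maybe using (Maybe; just; nothing)
open import Data.Maybe.Properties using (just-injective)
open import Data.Bool using (true; false)
open import Data.List using (List; []; _∷_)
open import Data.List.Relation.Unary.Any using (here; there)
open import Data.List.Membership.Propositional using (_∈_; _∉_)
open import Data.List.Relation.Binary.Permutation.Propositional using (↭-sym)
open import Data.List.Relation.Binary.Permutation.Propositional.Properties using (∈-resp-↭)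
open import Data.Product using (Σ; _×_; _,_; proj₁; proj₂; ∃)
open import Data.Sum using (_⊎_; inj₁; inj₂; [_,_])
open import Effect.Monad using (RawMonad)
open import Relation.Nullary using (¬_; yes; no)
open import Relation.Nullary.Decidable using (Dec; ¬¬-excluded-middle)
open import Relation.Nullary.Negation using (¬¬-Monad; contradiction)
open import Relation.Binary.PropositionalEquality using (_≡_; _≢_; refl; sym; trans; cong)

open RawMonad (¬¬-Monad {0ℓ}) using (pure; _>>=_)

module _ {n : ℕ} {R : VRel n} where

  infixr 5 _++_

  _++_ : ∀ {a b c} → Walk R a b → Walk R b c → Walk R a c
  [] ++ ρ = ρ
  (r ∷ π) ++ ρ = r ∷ (π ++ ρ)

  length : ∀ {a b} → Walk R a b → ℕ
  length [] = 0
  length (r ∷ π) = suc (length π)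

  on-start : ∀ {a b} (π : Walk R a b) → OnWalk a π
  on-start [] = here-[]
  on-start (r ∷ π) = here-∷ r π

  on-end : ∀ {a b} (π : Walk R a b) → OnWalk b π
  on-end [] = here-[]
  on-end (r ∷ π) = there r (on-end π)

  on-++⁻ : ∀ {x a b c} (π : Walk R a b) {ρ : Walk R b c} →
           OnWalk x (π ++ ρ) → OnWalk x π ⊎ OnWalk x ρ
  on-++⁻ [] o = inj₂ o
  on-++⁻ (r ∷ π) (here-∷ _ _) = inj₁ (here-∷ r π)
  on-++⁻ (r ∷ π) (there _ o) with on-++⁻ π o
  ... | inj₁ o′ = inj₁ (there r o′)
  ... | inj₂ o′ = inj₂ o′

  onWalk? : ∀ x {a b} (π : Walk R a b) → Dec (OnWalk x π)
  onWalk? x {a} π with x ≟ a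
  onWalk? x (r ∷ π) | no x≢a with onWalk? x π
  ... | yes o = yes (there r o)
  ... | no ¬o = no λ { (here-∷ _ _) → x≢a refl ; (there _ o) → ¬o o }
  onWalk? x []      | no x≢a = no λ { here-[] → x≢a refl }
  onWalk? x π       | yes refl = yes (on-start π)

module _ {n : ℕ} {R S : VRel n} (f : ∀ {a b} → R a b → S a b) where

  map : ∀ {a b} → Walk R a b → Walk S a b
  map [] = []
  map (r ∷ π) = f r ∷ map π

  on-map⁻ : ∀ {x a b} (π : Walk R a b) → OnWalk x (map π) → OnWalk x π
  on-map⁻ [] here-[] = here-[]
  on-map⁻ (r ∷ π) (here-∷ _ _) = here-∷ r π
  on-map⁻ (r ∷ π) (there _ o) = there r (on-map⁻ π o)

module _ {n : ℕ} {R : VRel n} {P : Fin n → Set} where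

  on-restricted : ∀ {a b x} (π : Walk (Restrict R P) a b) → P a → OnWalk x π → P x
  on-restricted [] pa here-[] = pa
  on-restricted (r ∷ π) pa (here-∷ _ _) = pa
  on-restricted ((_ , pb , _) ∷ π) pa (there _ o) = on-restricted π pb o

  restrict : ∀ {a b} (π : Walk R a b) → (∀ {z} → OnWalk z π → P z) → Walk (Restrict R P) a b
  restrict [] _ = []
  restrict (r ∷ π) onP =
    (onP (here-∷ r π) , onP (there r (on-start π)) , r) ∷ restrict π (λ o → onP (there r o))

  unrestrict : ∀ {a b} → Walk (Restrict R P) a b → Walk R a b
  unrestrict = map (λ (_ , _ , r) → r)

  weaken-restricted : ∀ {P′ : Fin n → Set} → (∀ {z} → P z → P′ z) →
                      ∀ {a b} → Walk (Restrict R P) a b → Walk (Restrict R P′) a b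
  weaken-restricted P⇒P′ = map (λ (pa , pb , r) → P⇒P′ pa , P⇒P′ pb , r)

Avoiding : ∀ {n} → VRel n → Fin n → Fin n → Fin n → Set
Avoiding R x a b = Σ (Walk R a b) λ π → ¬ OnWalk x π

module _ {n : ℕ} {R : VRel n} {x : Fin n} where

  avoids-end : ∀ {a b} → Avoiding R x a b → b ≢ x
  avoids-end (π , x∉π) refl = x∉π (on-end π)

  avoiding-[] : ∀ {a} → a ≢ x → Avoiding R x a a
  avoiding-[] a≢x = [] , λ { here-[] → a≢x refl }

  infixr 5 _++ᵃ_ _▷⟨_⟩_

  _++ᵃ_ : ∀ {a b c} → Avoiding R x a b → Avoiding R x b c → Avoiding R x a c
  (π , x∉π) ++ᵃ (ρ , x∉ρ) = π ++ ρ , λ o → [ x∉π , x∉ρ ] (on-++⁻ π o)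

  _▷⟨_⟩_ : ∀ {a b c d} → Avoiding R x a b → R b c → Avoiding R x c d → Avoiding R x a d
  π ▷⟨ r ⟩ (ρ , x∉ρ) =
    π ++ᵃ (r ∷ ρ , λ { (here-∷ _ _) → avoids-end π refl ; (there _ o) → x∉ρ o })

  avoiding-restricted : ∀ {P : Fin n → Set} {a b} → Walk (Restrict R P) a b → P a → ¬ P x →
                        Avoiding R x a b
  avoiding-restricted π pa ¬px = unrestrict π , λ o → ¬px (on-restricted π pa (on-map⁻ _ π o))

avoiding-map : ∀ {n} {R S : VRel n} → (∀ {a b} → R a b → S a b) →
               ∀ {x a b} → Avoiding R x a b → Avoiding S x a b
avoiding-map f (π , x∉π) = map f π , λ o → x∉π (on-map⁻ f π o)

dominators-transfer : ∀ {n} {R S : VRel n} {s x} →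
                      (∀ {y} → Avoiding S x s y → ¬ ¬ Avoiding R x s y) →
                      ∀ {y} → Dominates R s x y → Dominates S s x y
dominators-transfer simulate x-dom π with onWalk? _ π
... | yes o = o
... | no x∉π = contradiction (π , x∉π) λ av → simulate av λ (ρ , x∉ρ) → x∉ρ (x-dom ρ)

record Crossing {n} {R : VRel n} (Q : Fin n → Set) {a b} (π : Walk R a b) : Set where
  field
    {last-out first-in} : Fin n
    prefix         : Walk R a last-out
    crossing-arc   : R last-out first-in
    outside        : ¬ Q last-out
    inside         : Q first-in
    prefix-shorter : length prefix < length π
    prefix-⊆       : ∀ {z} → OnWalk z prefix → OnWalk z π

first-crossing : ∀ {n} {R : VRel n} (Q : Fin n → Set) {a b} (π : Walk R a b) →
                 ¬ Q a → Q b → ¬ ¬ Crossing Q π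
first-crossing Q [] ¬qa qb = contradiction qb ¬qa
first-crossing Q (_∷_ {b = c} r π) ¬qa qb = ¬¬-excluded-middle {A = Q c} >>= λ where
  (yes qc) → pure record
    { prefix = [] ; crossing-arc = r ; outside = ¬qa ; inside = qc
    ; prefix-shorter = s≤s z≤n ; prefix-⊆ = λ { here-[] → here-∷ r π } }
  (no ¬qc) → first-crossing Q π ¬qc qb >>= λ cr → let open Crossing cr in pure record
    { prefix = r ∷ prefix ; crossing-arc = crossing-arc ; outside = outside ; inside = inside
    ; prefix-shorter = s≤s prefix-shorter
    ; prefix-⊆ = λ { (here-∷ _ _) → here-∷ r π ; (there _ o) → there r (prefix-⊆ o) } }

Least Greatest : ∀ {n} → (Fin n → ℕ) → (Fin n → Set) → Fin n → Set
Least μ Q m = Q m × (∀ c → Q c → μ m ≤ μ c)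
Greatest μ Q m = Q m × (∀ c → Q c → μ c ≤ μ m)

least : ∀ {n} (μ : Fin n → ℕ) (Q : Fin n → Set) {c} → Q c → ¬ ¬ ∃ (Least μ Q)
least μ Q qc = go qc (<-wellFounded _)
  where
  go : ∀ {c} → Q c → Acc _<_ (μ c) → ¬ ¬ ∃ (Least μ Q)
  go {c} qc (acc smaller) = ¬¬-excluded-middle {A = ∃ λ c′ → Q c′ × μ c′ < μ c} >>= λ where
    (yes (c′ , qc′ , lt)) → go qc′ (smaller lt)
    (no none) → pure (c , qc , λ c′ qc′ → ≮⇒≥ λ lt → none (c′ , qc′ , lt))

greatest : ∀ {n} (μ : Fin n → ℕ) (Q : Fin n → Set) {B} → (∀ {c} → Q c → μ c ≤ B) →
           ∀ {c} → Q c → ¬ ¬ ∃ (Greatest μ Q)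
greatest μ Q {B} bounded qc = least (λ c → B ∸ μ c) Q qc >>= λ (m , qm , minimal) →
  pure (m , qm , λ c qc → ∸-cancelʳ-≤ (bounded qc) (minimal c qc))

record SpanningTree {n} (E : Adj n) (s : Fin n) (p : Fin n → Maybe (Fin n)) : Set where
  field
    root-parentless : p s ≡ nothing
    rooted          : ∀ y → Anc p s y
    parent-arc      : ∀ {y z} → p y ≡ just z → Arc E z y

module DepthFirstSearch {n : ℕ} (E : Adj n) (s : Fin n) where

  Extends : State n → State n → Set
  Extends σ σ′ = ∀ {y} → visited σ y ≡ true → visited σ′ y ≡ true × parent σ′ y ≡ parent σ y

  extends-refl : ∀ {σ} → Extends σ σ
  extends-refl vy = vy , refl

  extends-trans : ∀ {σ σ′ σ″} → Extends σ σ′ → Extends σ′ σ″ → Extends σ σ″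
  extends-trans σ⊑σ′ σ′⊑σ″ vy =
    let vy′ , py′ = σ⊑σ′ vy ; vy″ , py″ = σ′⊑σ″ vy′ in vy″ , trans py″ py′

  record Invariant (σ : State n) : Set where
    field
      root-visited    : visited σ s ≡ true
      root-parentless : parent σ s ≡ nothing
      parent-arc      : ∀ {y z} → parent σ y ≡ just z → Arc E z y
      parent-visited  : ∀ {y z} → parent σ y ≡ just z → visited σ z ≡ true
      visited-rooted  : ∀ {y} → visited σ y ≡ true → Anc (parent σ) s y
  open Invariant

  rooted-extends : ∀ {σ σ′} → Invariant σ → Extends σ σ′ →
                   ∀ {y} → visited σ y ≡ true → Anc (parent σ) s y → Anc (parent σ′) s y
  rooted-extends I σ⊑σ′ vy anc-refl = anc-refl
  rooted-extends I σ⊑σ′ vy (anc-step e α) =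
    anc-step (trans (proj₂ (σ⊑σ′ vy)) e) (rooted-extends I σ⊑σ′ (parent-visited I e) α)

  module _ {σ : State n} {w u : Fin n} where

    visit-self : visited (visit w u σ) w ≡ true × parent (visit w u σ) w ≡ just u
    visit-self with w ≟ w
    ... | yes _ = refl , refl
    ... | no w≢w = contradiction refl w≢w

    visit-other : ∀ {y} → y ≢ w →
                  visited (visit w u σ) y ≡ visited σ y × parent (visit w u σ) y ≡ parent σ y
    visit-other {y} y≢w with y ≟ w
    ... | yes y≡w = contradiction y≡w y≢w
    ... | no _ = refl , refl

    visit-extends : visited σ w ≡ false → Extends σ (visit w u σ)
    visit-extends vw {y} vy with y ≟ w
    ... | yes refl = contradiction (trans (sym vy) vw) λ ()
    ... | no _ = vy , refl

    parent-visit : ∀ {y z} → parent (visit w u σ) y ≡ just z →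
                   (y ≡ w × z ≡ u) ⊎ parent σ y ≡ just z
    parent-visit {y} e with y ≟ w
    ... | yes y≡w = inj₁ (y≡w , sym (just-injective e))
    ... | no _ = inj₂ e

    visit-invariant : Invariant σ → visited σ u ≡ true → visited σ w ≡ false → Arc E u w →
                      Invariant (visit w u σ)
    visit-invariant I vu vw uw = record
      { root-visited    = proj₁ (σ⊑σ′ (root-visited I))
      ; root-parentless = trans (proj₂ (visit-other s≢w)) (root-parentless I)
      ; parent-arc      = λ e → [ (λ { (refl , refl) → uw }) , parent-arc I ] (parent-visit e)
      ; parent-visited  = λ e →
          proj₁ (σ⊑σ′ ([ (λ { (_ , refl) → vu }) , parent-visited I ] (parent-visit e)))
      ; visited-rooted  = rooted
      }
      where
      σ⊑σ′ : Extends σ (visit w u σ)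
      σ⊑σ′ = visit-extends vw
      s≢w : s ≢ w
      s≢w refl = contradiction (trans (sym (root-visited I)) vw) λ ()
      rooted : ∀ {y} → visited (visit w u σ) y ≡ true → Anc (parent (visit w u σ)) s y
      rooted {y} vy with y ≟ w
      ... | yes refl = anc-step (proj₂ visit-self) (rooted-extends I σ⊑σ′ vu (visited-rooted I vu))
      ... | no _ = rooted-extends I σ⊑σ′ vy (visited-rooted I vy)

  record ScanResult (ws : List (Fin n)) (σ σ′ : State n) : Set where
    field
      invariant : Invariant σ′
      extends   : Extends σ σ′
      scanned   : ∀ {w} → w ∈ ws → visited σ′ w ≡ true
      closed    : ∀ {y} → visited σ y ≡ false → visited σ′ y ≡ true →
                  ∀ {z} → Arc E y z → visited σ′ z ≡ true
  open ScanResult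

  scan-result : ∀ {u ws σ σ′} → DFSScan E u ws σ σ′ → Invariant σ → visited σ u ≡ true →
                (∀ {w} → w ∈ ws → Arc E u w) → ScanResult ws σ σ′
  scan-result {σ = σ} scan-[] I _ _ = record
    { invariant = I ; extends = extends-refl {σ} ; scanned = λ ()
    ; closed = λ vf vt → contradiction (trans (sym vt) vf) λ () }
  scan-result (scan-old vw rest) I vu ws⊆Eu = record
    { invariant = invariant R ; extends = extends R ; closed = closed R
    ; scanned = λ { (here refl) → proj₁ (extends R vw) ; (there w∈ws) → scanned R w∈ws } }
    where
    R : ScanResult _ _ _
    R = scan-result rest I vu (λ w∈ws → ws⊆Eu (there w∈ws))
  scan-result {u} {σ = σ} (scan-new {w} {σ₁ = σ₁} {σ₂} vw perm inner rest) I vu ws⊆Eu = record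
    { invariant = invariant Outer
    ; extends   = extends-trans {σ} {σ₁} {σ₂}
                    (extends-trans {σ} {visit w u σ} {σ₁} σ⊑σᵥ (extends Inner)) (extends Outer)
    ; scanned   = λ { (here refl) → proj₁ (extends Outer w-visited) ; (there w∈ws) → scanned Outer w∈ws }
    ; closed    = closed′
    }
    where
    σ⊑σᵥ : Extends σ (visit w u σ)
    σ⊑σᵥ = visit-extends {σ} {w} {u} vw
    Inner : ScanResult _ (visit w u σ) σ₁
    Inner = scan-result inner (visit-invariant I vu vw (ws⊆Eu (here refl)))
                        (proj₁ (visit-self {σ} {w} {u})) (∈-resp-↭ perm)
    Outer : ScanResult _ σ₁ σ₂
    Outer = scan-result rest (invariant Inner) (proj₁ (extends Inner (proj₁ (σ⊑σᵥ vu))))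
                        (λ w∈ws → ws⊆Eu (there w∈ws))
    w-visited : visited σ₁ w ≡ true
    w-visited = proj₁ (extends Inner (proj₁ (visit-self {σ} {w} {u})))
    closed′ : ∀ {y} → visited σ y ≡ false → visited σ₂ y ≡ true →
              ∀ {z} → Arc E y z → visited σ₂ z ≡ true
    closed′ {y} vf vt yz with visited σ₁ y in v₁
    ... | false = closed Outer v₁ vt yz
    ... | true with y ≟ w
    ...   | yes refl = proj₁ (extends Outer (scanned Inner (∈-resp-↭ (↭-sym perm) yz)))
    ...   | no y≢w =
      proj₁ (extends Outer (closed Inner (trans (proj₁ (visit-other {σ} {w} {u} y≢w)) vf) v₁ yz))

  initial-invariant : Invariant (initState s)
  initial-invariant = record
    { root-visited = root-visited′ ; root-parentless = refl
    ; parent-arc = λ () ; parent-visited = λ () ; visited-rooted = rooted }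
    where
    root-visited′ : visited (initState s) s ≡ true
    root-visited′ with s ≟ s
    ... | yes _ = refl
    ... | no s≢s = contradiction refl s≢s
    rooted : ∀ {y} → visited (initState s) y ≡ true → Anc (parent (initState s)) s y
    rooted {y} vy with y ≟ s
    ... | yes refl = anc-refl
    rooted () | no _

  initially-unvisited : ∀ {y} → y ≢ s → visited (initState s) y ≡ false
  initially-unvisited {y} y≢s with y ≟ s
  ... | yes y≡s = contradiction y≡s y≢s
  ... | no _ = refl

  dfs-spanningTree : (∀ y → Walk (Arc E) s y) → ∀ {p} → IsDFSTree E s p → SpanningTree E s p
  dfs-spanningTree reachable (vis , ws , perm , run) = record
    { root-parentless = root-parentless (invariant R)
    ; rooted          = λ y →
        visited-rooted (invariant R) (reached (reachable y) (root-visited (invariant R)))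
    ; parent-arc      = parent-arc (invariant R)
    }
    where
    R : ScanResult ws (initState s) (st vis _)
    R = scan-result run initial-invariant (root-visited initial-invariant) (∈-resp-↭ perm)
    out-closed : ∀ {y} → vis y ≡ true → ∀ {z} → Arc E y z → vis z ≡ true
    out-closed {y} vy yz with y ≟ s
    ... | yes refl = scanned R (∈-resp-↭ (↭-sym perm) yz)
    ... | no y≢s = closed R (initially-unvisited y≢s) vy yz
    reached : ∀ {a b} → Walk (Arc E) a b → vis a ≡ true → vis b ≡ true
    reached [] va = va
    reached (ab ∷ π) va = reached π (out-closed va ab)

module _ {n : ℕ} {p : Fin n → Maybe (Fin n)} where

  Anc-trans : ∀ {a b c} → Anc p a b → Anc p b c → Anc p a c
  Anc-trans ab anc-refl = ab
  Anc-trans ab (anc-step e bc) = anc-step e (Anc-trans ab bc)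

  Anc-comparable : ∀ {a b y} → Anc p a y → Anc p b y → Anc p a b ⊎ Anc p b a
  Anc-comparable anc-refl β = inj₂ β
  Anc-comparable α@(anc-step _ _) anc-refl = inj₁ α
  Anc-comparable (anc-step e α) (anc-step e′ β) with trans (sym e) e′
  ... | refl = Anc-comparable α β

  ParentOf : VRel n
  ParentOf a b = p b ≡ just a

  tree-walk : ∀ {a b} → Anc p a b → Walk ParentOf a b
  tree-walk anc-refl = []
  tree-walk (anc-step e α) = tree-walk α ++ (e ∷ [])

  on-tree-walk : ∀ {a b z} (α : Anc p a b) → OnWalk z (tree-walk α) → Anc p a z × Anc p z b
  on-tree-walk anc-refl here-[] = anc-refl , anc-refl
  on-tree-walk (anc-step e α) o with on-++⁻ (tree-walk α) o
  ... | inj₁ o′ = proj₁ (on-tree-walk α o′) , anc-step e (proj₂ (on-tree-walk α o′))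
  ... | inj₂ (here-∷ _ _) = α , anc-step e anc-refl
  ... | inj₂ (there _ here-[]) = anc-step e α , anc-refl

  tree-avoiding-nonancestor : ∀ {x a b} → Anc p a b → ¬ Anc p x b → Avoiding ParentOf x a b
  tree-avoiding-nonancestor α ¬xb = tree-walk α , λ o → ¬xb (proj₂ (on-tree-walk α o))

  tree-avoiding-nondescendant : ∀ {x a b} → Anc p a b → ¬ Anc p a x → Avoiding ParentOf x a b
  tree-avoiding-nondescendant α ¬ax = tree-walk α , λ o → ¬ax (proj₁ (on-tree-walk α o))

module RootedTree {n : ℕ} {p : Fin n → Maybe (Fin n)} {s : Fin n}
                  (root-parentless : p s ≡ nothing) (rooted : ∀ y → Anc p s y) where

  private
    height : ∀ {a b} → Anc p a b → ℕ
    height anc-refl = 0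
    height (anc-step _ α) = suc (height α)

    root-has-no-parent : ∀ {z} → ¬ p s ≡ just z
    root-has-no-parent e with trans (sym root-parentless) e
    ... | ()

    height-unique : ∀ {y} (α β : Anc p s y) → height α ≡ height β
    height-unique anc-refl anc-refl = refl
    height-unique anc-refl (anc-step e _) = contradiction e root-has-no-parent
    height-unique (anc-step e _) anc-refl = contradiction e root-has-no-parent
    height-unique (anc-step e α) (anc-step e′ β) with trans (sym e) e′
    ... | refl = cong suc (height-unique α β)

  depth : Fin n → ℕ
  depth y = height (rooted y)

  depth-parent : ∀ {y z} → p y ≡ just z → depth z < depth y
  depth-parent {y} e with rooted y
  ... | anc-refl = contradiction e root-has-no-parent
  ... | anc-step e′ α with trans (sym e) e′
  ...   | refl = s≤s (≤-reflexive (height-unique (rooted _) α))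

  Anc⇒depth-≤ : ∀ {a b} → Anc p a b → depth a ≤ depth b
  Anc⇒depth-≤ anc-refl = ≤-refl
  Anc⇒depth-≤ (anc-step e α) = ≤-trans (Anc⇒depth-≤ α) (<⇒≤ (depth-parent e))

  Anc∧depth-≥⇒≡ : ∀ {a b} → Anc p a b → depth b ≤ depth a → a ≡ b
  Anc∧depth-≥⇒≡ anc-refl _ = refl
  Anc∧depth-≥⇒≡ (anc-step e α) b≤a =
    contradiction (<-≤-trans (≤-<-trans (Anc⇒depth-≤ α) (depth-parent e)) b≤a) (<-irrefl refl)

  Anc-antisym : ∀ {a b} → Anc p a b → Anc p b a → a ≡ b
  Anc-antisym ab ba = Anc∧depth-≥⇒≡ ab (Anc⇒depth-≤ ba)

  ProperAnc⇒depth-< : ∀ {a b} → ProperAnc p a b → depth a < depth b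
  ProperAnc⇒depth-< (ab , a≢b) = ≰⇒> λ b≤a → a≢b (Anc∧depth-≥⇒≡ ab b≤a)

  Anc-root : ∀ {a} → Anc p a s → a ≡ s
  Anc-root as = Anc-antisym as (rooted _)

  parent-of-nonroot : ∀ {y} → y ≢ s → ∃ λ z → p y ≡ just z
  parent-of-nonroot {y} y≢s with rooted y
  ... | anc-refl = contradiction refl y≢s
  ... | anc-step e _ = _ , e

  parent-nondescendant : ∀ {a q x} → p a ≡ just q → Anc p a x → ¬ Anc p x q
  parent-nondescendant e ax xq =
    <-irrefl refl (<-≤-trans (depth-parent e) (Anc⇒depth-≤ (Anc-trans ax xq)))

  parent-arc-not-back : ∀ {a q} → p a ≡ just q → ¬ BackArc p q a
  parent-arc-not-back e (aq , _) = parent-nondescendant e anc-refl aq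

  Anc-by-depth : ∀ {a b y} → Anc p a y → Anc p b y → depth a ≤ depth b → Anc p a b
  Anc-by-depth ay by a≤b with Anc-comparable ay by
  ... | inj₁ ab = ab
  ... | inj₂ ba rewrite Anc∧depth-≥⇒≡ ba a≤b = anc-refl

module LoopNesting {n : ℕ} (E : Adj n) (s : Fin n) (no-enter-s : ∀ v → s ∉ E v)
                   {p : Fin n → Maybe (Fin n)} (T : SpanningTree E s p) where
  open SpanningTree T
  open RootedTree root-parentless rooted

  G G′ : VRel n
  G = Arc E
  G′ = Arc′ E p

  tree-arc′ : ∀ {a b} → ParentOf {p = p} a b → G′ a b
  tree-arc′ e = kept (parent-arc e) (parent-arc-not-back e)

  loop-∋-head : ∀ {u} → InLoop E p u u
  loop-∋-head = anc-refl , []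

  loop-∋-predecessor : ∀ {u v w} → Anc p u v → G v w → InLoop E p u w → InLoop E p u v
  loop-∋-predecessor uv vw (uw , wu) = uv , (uv , uw , vw) ∷ wu

  loop-⊆ : ∀ {U c z} → Anc p U c → InLoop E p U z → Anc p c z →
           ∀ {t} → InLoop E p c t → InLoop E p U t
  loop-⊆ Uc (_ , zU) cz (ct , tc) =
    Anc-trans Uc ct , weaken-restricted (Anc-trans Uc) tc ++ restrict (map parent-arc τ) below-U ++ zU
    where
    τ : Walk ParentOf _ _
    τ = tree-walk cz
    below-U : ∀ {y} → OnWalk y (map parent-arc τ) → Anc p _ y
    below-U o = Anc-trans Uc (proj₁ (on-tree-walk cz (on-map⁻ parent-arc τ o)))

  loop-of-root : ∀ {x} → InLoop E p s x → x ≡ s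
  loop-of-root (_ , xs) = into-root xs
    where
    into-root : ∀ {a} → Walk (Restrict G (Anc p s)) a s → a ≡ s
    into-root [] = refl
    into-root ((_ , _ , ab) ∷ π) with into-root π
    ... | refl = contradiction ab (no-enter-s _)

  root-outside-loop : ∀ {u} → u ≢ s → ¬ InLoop E p u s
  root-outside-loop u≢s (us , _) = u≢s (Anc-root us)

  into-loop : ∀ {x u v w} → G v w → InLoop E p u w → u ≢ x → Avoiding G x s v → ¬ ¬ Avoiding G x s u
  into-loop {x} {u} vw (uw , wu) u≢x P = ¬¬-excluded-middle {A = Anc p u x} >>= λ where
    (yes ux) → pure (avoiding-map parent-arc
                       (tree-avoiding-nonancestor (rooted u) λ xu → u≢x (Anc-antisym ux xu)))
    (no ¬ux) → pure (P ▷⟨ vw ⟩ avoiding-restricted wu uw ¬ux)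

  simulate-arc′ : ∀ {x a b} → G′ a b → b ≢ x → Avoiding G x s a → ¬ ¬ Avoiding G x s b
  simulate-arc′ (kept ab _) b≢x P = pure (P ▷⟨ ab ⟩ avoiding-[] b≢x)
  simulate-arc′ (entry-arc _ ((vw , U∋w , _) , _)) U≢x P = into-loop vw U∋w U≢x P
  simulate-arc′ {x} (loop-arc {hu = hu} {v} ((hu-u , _) , _) ((vw , u∋w , _) , _)
                               ((_ , hu∋w , hu∌v) , _) q-hu) u≢x P =
    ¬¬-excluded-middle {A = Anc p hu x} >>= λ where
      (no ¬hux) → pure (P ▷⟨ parent-arc q-hu ⟩
                        avoiding-map parent-arc (tree-avoiding-nondescendant hu-u ¬hux))
      (yes hux) → into-loop vw u∋w u≢x (avoiding-map parent-arc (tree-avoiding-nonancestor (rooted v)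
                    λ xv → hu∌v (loop-∋-predecessor (Anc-trans hux xv) vw hu∋w)))

  G′-avoiding⇒G : ∀ {x y} → Avoiding G′ x s y → ¬ ¬ Avoiding G x s y
  G′-avoiding⇒G (π , x∉π) = go π x∉π (avoiding-[] λ { refl → x∉π (on-start π) })
    where
    go : ∀ {x a b} (π : Walk G′ a b) → ¬ OnWalk x π → Avoiding G x s a → ¬ ¬ Avoiding G x s b
    go [] _ P = pure P
    go (r ∷ π) x∉π P =
      simulate-arc′ r (λ { refl → x∉π (there r (on-start π)) }) P >>= go π λ o → x∉π (there r o)

  largest-entry-loop : ∀ {u v w} → Entry E p u v w → ¬ ¬ ∃ λ U → LargestEntryLoop E p U v w
  largest-entry-loop {v = v} {w} ent = least depth (λ c → Entry E p c v w) ent >>=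
    λ (U , entU@(_ , U∋w@(Uw , _) , _) , shallowest) → pure (U , entU ,
      λ { u′ entu′@(_ , (u′w , _) , _) _ →
            loop-⊆ (Anc-by-depth Uw u′w (shallowest u′ entu′)) U∋w u′w })

  loop-parent : ∀ {U u} → ProperAnc p U u → InLoop E p U u → ¬ ¬ ∃ (IsH E p u)
  loop-parent {u = u} U<u U∋u =
    greatest depth Encloses (λ ((cu , _) , _) → Anc⇒depth-≤ cu) (U<u , U∋u) >>=
    λ (hu , (hu<u , hu∋u) , deepest) → pure
      (hu , hu<u , hu∋u , λ c c<u c∋u → Anc-by-depth (proj₁ c<u) (proj₁ hu<u) (deepest c (c<u , c∋u)))
    where
    Encloses : Fin n → Set
    Encloses c = ProperAnc p c u × InLoop E p c u

  entry-between : ∀ {U c u v w} → Entry E p U v w → Anc p U c → Anc p c u → InLoop E p c u →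
                  InLoop E p u w → Entry E p c v w
  entry-between (vw , U∋w , U∌v) Uc cu c∋u u∋w =
    vw , c∋w , λ c∋v → U∌v (loop-⊆ Uc U∋w (proj₁ c∋w) c∋v)
    where
    c∋w : InLoop E p _ _
    c∋w = loop-⊆ cu c∋u anc-refl u∋w

  Outermost : Fin n → Fin n → Set
  Outermost x u = ∀ c → ProperAnc p c u → InLoop E p c u → ¬ ProperAnc p x c

  reach-via-loop-arc : ∀ {x u U v w} → ProperAnc p x u → Outermost x u → NonHeadEntry E p u v w →
                       Entry E p U v w → Anc p U x → InLoop E p U u → ¬ ¬ Avoiding G′ x s u
  reach-via-loop-arc {x} {u} {U} (xu , x≢u) outermost nhe@((_ , u∋w , _) , _) entU Ux U∋u =
    loop-parent (proj₁ U∋u , U≢u) U∋u >>= λ (hu , isH) → pure (via-parent-of hu isH)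
    where
    U≢u : U ≢ u
    U≢u refl = x≢u (Anc-antisym xu Ux)
    via-parent-of : ∀ hu → IsH E p u hu → Avoiding G′ x s u
    via-parent-of hu isH@((hu-u , hu≢u) , hu∋u , nearest) =
      avoiding-map tree-arc′ (tree-avoiding-nonancestor (rooted q) (parent-nondescendant q-hu hu-x))
        ▷⟨ loop-arc isH nhe (entry-between entU U-hu hu-u hu∋u u∋w , w≢hu) q-hu ⟩
      avoiding-[] (λ u≡x → x≢u (sym u≡x))
      where
      hu-x : Anc p hu x
      hu-x with Anc-comparable hu-u xu
      ... | inj₁ hux = hux
      ... | inj₂ xhu with x ≟ hu
      ...   | yes refl = anc-refl
      ...   | no x≢hu = contradiction (xhu , x≢hu) (outermost hu (hu-u , hu≢u) hu∋u)
      hu≢s : hu ≢ s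
      hu≢s refl with loop-of-root hu∋u
      ... | refl = x≢u (Anc-root xu)
      q : Fin n
      q = proj₁ (parent-of-nonroot hu≢s)
      q-hu : p hu ≡ just q
      q-hu = proj₂ (parent-of-nonroot hu≢s)
      U-hu : Anc p U hu
      U-hu = nearest U (proj₁ U∋u , U≢u) U∋u
      w≢hu : _ ≢ hu
      w≢hu refl = hu≢u (Anc-antisym hu-u (proj₁ u∋w))

  reach-loop-head : ∀ {x u v w} → ProperAnc p x u → Outermost x u → Entry E p u v w →
                    Avoiding G′ x s v → ¬ ¬ Avoiding G′ x s u
  reach-loop-head {x} {u} {v} {w} x<u@(xu , x≢u) outermost ent@(vw , u∋w , u∌v) P with w ≟ u
  ... | yes refl = pure (P ▷⟨ kept vw (λ (uv , _) → u∌v (loop-∋-predecessor uv vw u∋w)) ⟩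
                         avoiding-[] λ u≡x → x≢u (sym u≡x))
  ... | no w≢u = largest-entry-loop ent >>= λ (U , largest@(entU , U⊇)) →
    let U∋u = U⊇ u ent u loop-∋-head in
    ¬¬-excluded-middle {A = Anc p U x} >>= λ where
      (yes Ux) → reach-via-loop-arc x<u outermost (ent , w≢u) entU Ux U∋u
      (no ¬Ux) → pure (P ▷⟨ entry-arc (u , ent , w≢u) largest ⟩
                       avoiding-map tree-arc′ (tree-avoiding-nondescendant (proj₁ U∋u) ¬Ux))

  G-avoiding⇒G′ : ∀ {x y} → Avoiding G x s y → ¬ ¬ Avoiding G′ x s y
  G-avoiding⇒G′ (P , x∉P) = go P (<-wellFounded (length P)) x∉P
    where
    go : ∀ {x y} (P : Walk G s y) → Acc _<_ (length P) → ¬ OnWalk x P → ¬ ¬ Avoiding G′ x s y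
    go {x} {y} P (acc smaller) x∉P = ¬¬-excluded-middle {A = Anc p x y} >>= λ where
        (no ¬xy) → pure (avoiding-map tree-arc′ (tree-avoiding-nonancestor (rooted y) ¬xy))
        (yes xy) → least depth (λ c → ProperAnc p x c × InLoop E p c y) ((xy , x≢y) , loop-∋-head)
                     >>= λ (u , shallowest) → through-loop-of u shallowest
      where
      x≢y : x ≢ y
      x≢y refl = x∉P (on-end P)
      through-loop-of : ∀ u → Least depth (λ c → ProperAnc p x c × InLoop E p c y) u →
                        ¬ ¬ Avoiding G′ x s y
      through-loop-of u ((x<u@(xu , x≢u) , u∋y) , shallowest) =
        first-crossing (InLoop E p u) P u∌s u∋y >>= λ cr → let open Crossing cr in
        go prefix (smaller prefix-shorter) (λ o → x∉P (prefix-⊆ o)) >>= λ P₀ →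
        reach-loop-head x<u outermost (crossing-arc , inside , outside) P₀ >>= λ Pᵤ →
        pure (Pᵤ ++ᵃ avoiding-map tree-arc′
                       (tree-avoiding-nondescendant (proj₁ u∋y) λ ux → x≢u (Anc-antisym xu ux)))
        where
        u∌s : ¬ InLoop E p u s
        u∌s = root-outside-loop λ { refl → x≢u (Anc-root xu) }
        outermost : Outermost x u
        outermost c c<u@(cu , _) c∋u x<c =
          <-irrefl refl (<-≤-trans (ProperAnc⇒depth-< c<u)
                                   (shallowest c (x<c , loop-⊆ cu c∋u anc-refl u∋y)))

theorem10 : ∀ {n} (E : Adj n) (s : Fin n) → IsFlowGraph E s →
    (p : Fin n → Maybe (Fin n)) → IsDFSTree E s p →
    ∀ x y → (Dominates (Arc E) s x y → Dominates (Arc′ E p) s x y)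
          × (Dominates (Arc′ E p) s x y → Dominates (Arc E) s x y)
theorem10 E s flow p dfs x y = dominators-transfer G′-avoiding⇒G , dominators-transfer G-avoiding⇒G′
  where
  open IsFlowGraph flow using (no-enter-s; reachable)
  open LoopNesting E s no-enter-s (DepthFirstSearch.dfs-spanningTree E s reachable dfs)
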